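{- The regular paperfolding word contains, for every integer $m\geq 2$, an abelian $m$-antipower as a factor.
   Context: Paperfolding words: given a sequence $\mathbf{b}=b_0b_1\cdots\in\{ -1,1\}^{\mathbb N}$, the associated paperfolding word $\mathbf{f}=f_1f_2\cdots$ over $\{0,1\}$ is defined by: for $i\ge1$ write $i=2^k(2j+1)$; then $f_i=1$ iff $i\equiv 2^k(2+b_k)\pmod{2^{k+2}}$, else $f_i=0$. The regular paperfolding word is the one with $b_k=1$ for all $k$. An abelian $m$-antipower is a word $u_1u_2\cdots u_m$ where the words $u_i$ all have the same length and have pairwise distinct Parikh vectors (the Parikh vector of a binary word records its numbers of $0$s and $1$s). A factor is a block of consecutive letters. -}

module Defs where

open import Data.Nat using (ℕ; zero; suc; _+_; _*_; _^_; _≡ᵇ_; _≤_)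
open import Data.Nat.DivMod using (_%_; _/_)
open import Data.Nat.Properties using (m^n≢0)
open import Data.Product using (∃₂)
open import Data.Bool using (Bool; true; false; if_then_else_)
open import Data.Integer using (ℤ; +_; -[1+_]) renaming (_+_ to _+ℤ_)
open import Data.Product using (_×_; _,_)
open import Data.List using (List; []; _∷_; map; length)
open import Data.List.Relation.Unary.AllPairs using (AllPairs)
open import Relation.Binary.PropositionalEquality using (_≡_; _≢_)

data Sign : Set where
  minus plus : Sign

signℤ : Sign → ℤ
signℤ minus = -[1+ 0 ]
signℤ plus  = + 1

-- 2-adic valuation with fuel (fuel ≥ i suffices for i ≥ 1)
val2-aux : ℕ → ℕ → ℕ
val2-aux zero    i = 0
val2-aux (suc f) i with i % 2 ≡ᵇ 0
... | true  = suc (val2-aux f (i / 2))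
... | false = 0

val2 : ℕ → ℕ
val2 i = val2-aux i i

-- 2 + b_k ∈ {1, 3}
twoPlus : Sign → ℕ
twoPlus minus = 1
twoPlus plus  = 3

-- letters of the paperfolding word: f_i = 1 iff i ≡ 2^k(2+b_k) mod 2^{k+2}
-- (both sides lie in [0, 2^{k+2}) after reduction; 2^k(2+b_k) < 2^{k+2})
paperfold : (ℕ → Sign) → ℕ → Bool
paperfold b i =
  let k = val2 i
      M = 2 ^ (k + 2)
      instance _ = m^n≢0 2 (k + 2)
  in (i % M) ≡ᵇ ((2 ^ k * twoPlus (b k)) % M)

regularSigns : ℕ → Sign
regularSigns _ = plus

-- regular paperfolding word, indexed from 1 (value at 0 is irrelevant)
regularPaperfolding : ℕ → Bool
regularPaperfolding = paperfold regularSigns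

factor : (ℕ → Bool) → ℕ → ℕ → List Bool
factor w p zero    = []
factor w p (suc n) = w p ∷ factor w (suc p) n

-- Parikh vector (number of 0s = false, number of 1s = true)
parikh : List Bool → ℕ × ℕ
parikh []           = 0 , 0
parikh (false ∷ xs) with parikh xs
... | (a , c) = suc a , c
parikh (true ∷ xs) with parikh xs
... | (a , c) = a , suc c

blocks : (ℕ → Bool) → ℕ → ℕ → ℕ → List (List Bool)
blocks w p n zero    = []
blocks w p n (suc m) = factor w p n ∷ blocks w (p + n) n m

HasAbelianAntipowerFactor : (ℕ → Bool) → ℕ → Set
HasAbelianAntipowerFactor w m =
  ∃₂ λ p n → (1 ≤ p) × AllPairs _≢_ (map parikh (blocks w p n m))

-- Let S n (prefixOnes) be the number of 1s among f₁ … fₙ. Then S (2y) = y − B y, where B y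
-- (deficit), the number of maximal runs of 1s in the binary expansion of y, is additive on
-- binary concatenations whose blocks are separated by a 0. Hence the window f_{2y+1} … f_{2y+2n} contains n + B y − B (y + n)
-- ones. Take y_j = Y₀ + j N whose binary expansion consists, for each c < 4m, of 3^c copies of
-- j + c: the window at y_j then contains N − K + Σ_{c<4m} 3^c δ(j + c) ones, where
-- δ t = B t + 1 − B (t + 1) = (t mod 2) + f_{t+1} ∈ {0, 1, 2}. These are base-3 numbers with
-- digits δ(j), …, δ(j + 4m − 1), and since f(2n) = f(n), f(4w+1) = 0 and f(4w+3) = 1, δ has no
-- period Δ on any interval of length 4Δ; so the m consecutive windows have distinct Parikh vectors.

module Submission where

open import Defs
open import Data.Bool using (Bool; true; false)
open import Data.Nat
open import Data.Nat.Properties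
open import Data.Nat.DivMod
open import Data.Nat.Induction using (<-rec)
open import Data.Nat.ListAction using (sum)
open import Data.Nat.ListAction.Properties using (sum-++)
open import Data.Nat.Tactic.RingSolver using (solve-∀)
open import Algebra.Properties.CommutativeSemigroup +-commutativeSemigroup
  using (xy∙z≈xz∙y; xy∙z≈x∙zy; interchange)
open import Data.List using (List; []; _∷_; _++_; map; applyUpTo)
open import Data.List.Properties using (map-++)
open import Data.List.Relation.Unary.AllPairs using (AllPairs)
open import Data.List.Relation.Unary.AllPairs.Properties using (applyUpTo⁺₁)
open import Data.Product using (∃-syntax; _×_; _,_; proj₁; proj₂)
open import Data.Sum using ([_,_]′)
open import Relation.Binary.PropositionalEquality
open import Function using (_∘_)

data Halving : ℕ → Set where
  even : ∀ h → Halving (h * 2)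
  odd  : ∀ h → Halving (suc (h * 2))

halving : ∀ n → Halving n
halving zero = even 0
halving (suc n) with halving n
... | even h = odd h
... | odd h  = even (suc h)

binaryInduction : (P : ℕ → Set) → P 0 → (∀ h → P h → P (h * 2)) →
                  (∀ h → P h → P (suc (h * 2))) → ∀ n → P n
binaryInduction P p0 pEven pOdd = <-rec P step
  where
  step : ∀ n → (∀ {m} → m < n → P m) → P n
  step n rec with halving n
  ... | even zero    = p0
  ... | even (suc h) = pEven (suc h) (rec (m<m*n (suc h) 2 ≤-refl))
  ... | odd h        = pOdd h (rec (s≤s (m≤m*n h 2)))

[1+h*2]%2≡1 : ∀ h → suc (h * 2) % 2 ≡ 1
[1+h*2]%2≡1 h = [m+kn]%n≡m%n 1 h 2

residue-window : ∀ n r → r < n → ∀ t → ∃[ c ] c < n × ∃[ q ] t + c ≡ q * n + r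
residue-window n r r<n zero = r , r<n , 0 , refl
residue-window (suc n′) r r<n (suc t) with residue-window (suc n′) r r<n t
... | zero  , _   , q , eq = n′ , ≤-refl , suc q , (begin
  suc t + n′                  ≡⟨ cong (λ x → suc x + n′) (trans (sym (+-identityʳ t)) eq) ⟩
  suc (q * suc n′ + r) + n′   ≡⟨ rotate (q * suc n′) r n′ ⟩
  suc n′ + q * suc n′ + r     ∎)
  where
  open ≡-Reasoning
  rotate : ∀ a r n → suc (a + r) + n ≡ suc n + a + r
  rotate = solve-∀
... | suc c , c<n , q , eq = c , <-trans (n<1+n c) c<n , q , trans (sym (+-suc t c)) eq

n<2^n : ∀ n → n < 2 ^ n
n<2^n zero    = s≤s z≤n
n<2^n (suc n) = begin-strict
  suc n          ≡⟨ +-identityʳ (suc n) ⟨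
  suc n + 0      <⟨ +-mono-≤-< (n<2^n n) (m^n>0 2 n) ⟩
  2 ^ n + 2 ^ n  ≡⟨ cong (2 ^ n +_) (+-identityʳ (2 ^ n)) ⟨
  2 ^ suc n      ∎
  where open ≤-Reasoning

⌊1+n/2⌋≡⌊n/2⌋+n%2 : ∀ n → ⌊ suc n /2⌋ ≡ ⌊ n /2⌋ + n % 2
⌊1+n/2⌋≡⌊n/2⌋+n%2 zero          = refl
⌊1+n/2⌋≡⌊n/2⌋+n%2 (suc zero)    = refl
⌊1+n/2⌋≡⌊n/2⌋+n%2 (suc (suc n)) = cong suc (⌊1+n/2⌋≡⌊n/2⌋+n%2 n)

⌈1+n/2⌉+n%2≡⌈n/2⌉+1 : ∀ n → ⌈ suc n /2⌉ + n % 2 ≡ ⌈ n /2⌉ + 1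
⌈1+n/2⌉+n%2≡⌈n/2⌉+1 zero          = refl
⌈1+n/2⌉+n%2≡⌈n/2⌉+1 (suc zero)    = refl
⌈1+n/2⌉+n%2≡⌈n/2⌉+1 (suc (suc n)) = cong suc (⌈1+n/2⌉+n%2≡⌈n/2⌉+1 n)

⌈n*2/2⌉≡n : ∀ n → ⌈ n * 2 /2⌉ ≡ n
⌈n*2/2⌉≡n zero    = refl
⌈n*2/2⌉≡n (suc n) = cong suc (⌈n*2/2⌉≡n n)

⌈1+n*2/2⌉≡1+n : ∀ n → ⌈ suc (n * 2) /2⌉ ≡ suc n
⌈1+n*2/2⌉≡1+n zero    = refl
⌈1+n*2/2⌉≡1+n (suc n) = cong suc (⌈1+n*2/2⌉≡1+n n)

-- Letters of the regular paperfolding word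

val2-aux-odd : ∀ fuel h → val2-aux (suc fuel) (suc (h * 2)) ≡ 0
val2-aux-odd fuel h rewrite [1+h*2]%2≡1 h = refl

val2-aux-even : ∀ fuel h → val2-aux (suc fuel) (h * 2) ≡ suc (val2-aux fuel h)
val2-aux-even fuel h rewrite m*n%n≡0 h 2 {{_}} | m*n/n≡m h 2 {{_}} = refl

-- At 0 the fuelled valuation returns its fuel, hence the argument suc n.
val2-aux-fuel : ∀ {fuel fuel′} n → n < fuel → n < fuel′ →
                val2-aux fuel (suc n) ≡ val2-aux fuel′ (suc n)
val2-aux-fuel {suc f} {suc f′} n _ _ with halving n
... | even h = trans (val2-aux-odd f h) (sym (val2-aux-odd f′ h))
val2-aux-fuel {suc f} {suc f′} _ (s≤s n<f) (s≤s n<f′) | odd h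
  rewrite val2-aux-even f (suc h) | val2-aux-even f′ (suc h) =
  cong suc (val2-aux-fuel h (half< n<f) (half< n<f′))
  where
  half< : ∀ {k} → suc (h * 2) ≤ k → h < k
  half< = <-≤-trans (s≤s (m≤m*n h 2))

val2-odd : ∀ h → val2 (suc (h * 2)) ≡ 0
val2-odd h = val2-aux-odd (h * 2) h

val2-double : ∀ h → val2 (suc h * 2) ≡ suc (val2 (suc h))
val2-double h = trans (val2-aux-even (suc (h * 2)) (suc h))
                      (cong suc (val2-aux-fuel h (s≤s (m≤m*n h 2)) ≤-refl))

*2-≡ᵇ : ∀ a b → (a * 2 ≡ᵇ b * 2) ≡ (a ≡ᵇ b)
*2-≡ᵇ zero    zero    = refl
*2-≡ᵇ zero    (suc b) = refl
*2-≡ᵇ (suc a) zero    = refl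
*2-≡ᵇ (suc a) (suc b) = *2-≡ᵇ a b

paperfolding-double : ∀ n → regularPaperfolding (n * 2) ≡ regularPaperfolding n
paperfolding-double zero = refl
paperfolding-double (suc h) rewrite val2-double h =
  trans (cong₂ _≡ᵇ_ (double (suc h)) (trans (%-congˡ (reassoc (2 ^ k))) (double (2 ^ k * 3))))
        (*2-≡ᵇ (suc h % 2 ^ (k + 2)) (2 ^ k * 3 % 2 ^ (k + 2)))
  where
  k : ℕ
  k = val2 (suc h)
  instance
    2^[k+2]≢0 : NonZero (2 ^ (k + 2))
    2^[k+2]≢0 = m^n≢0 2 (k + 2)
    2^[k+2]*2≢0 : NonZero (2 ^ (k + 2) * 2)
    2^[k+2]*2≢0 = m*n≢0 (2 ^ (k + 2)) 2
    2^[k+3]≢0 : NonZero (2 ^ (suc k + 2))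
    2^[k+3]≢0 = m^n≢0 2 (suc k + 2)
  double : ∀ a → a * 2 % (2 * 2 ^ (k + 2)) ≡ a % 2 ^ (k + 2) * 2
  double a = trans (%-congʳ (*-comm 2 (2 ^ (k + 2)))) (sym (m%n*o≡m*o%[n*o] a (2 ^ (k + 2)) 2))
  reassoc : ∀ x → 2 * x * 3 ≡ x * 3 * 2
  reassoc = solve-∀

[r+w*2*2]%4≡r : ∀ r w → r < 4 → (r + w * 2 * 2) % 4 ≡ r
[r+w*2*2]%4≡r r w r<4 = trans (%-congˡ (cong (r +_) (*-assoc w 2 2)))
                          (trans ([m+kn]%n≡m%n r w 4) (m<n⇒m%n≡m r<4))

paperfolding-4w+1 : ∀ w → regularPaperfolding (suc (w * 2 * 2)) ≡ false
paperfolding-4w+1 w rewrite val2-odd (w * 2) | [r+w*2*2]%4≡r 1 w (s≤s (s≤s z≤n)) = refl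

paperfolding-4w+3 : ∀ w → regularPaperfolding (suc (suc (w * 2) * 2)) ≡ true
paperfolding-4w+3 w rewrite val2-odd (suc (w * 2)) | [r+w*2*2]%4≡r 3 w ≤-refl = refl

bit : Bool → ℕ
bit false = 0
bit true  = 1

letter : ℕ → ℕ
letter n = bit (regularPaperfolding n)

letter-double : ∀ n → letter (n * 2) ≡ letter n
letter-double n = cong bit (paperfolding-double n)

letter-odd : ∀ h → letter (suc (h * 2)) ≡ h % 2
letter-odd h with halving h
... | even w rewrite paperfolding-4w+1 w = sym (m*n%n≡0 w 2)
... | odd w  rewrite paperfolding-4w+3 w = sym ([1+h*2]%2≡1 w)

letter-aperiodic : ∀ D → 0 < D → ∀ t → ∃[ c ] c < 4 * D × letter (t + c) ≢ letter (t + D * 2 + c)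
letter-aperiodic = binaryInduction P (λ ()) even-step odd-step
  where
  P : ℕ → Set
  P D = 0 < D → ∀ t → ∃[ c ] c < 4 * D × letter (t + c) ≢ letter (t + D * 2 + c)

  odd-step : ∀ o → P o → P (suc (o * 2))
  odd-step o _ _ t with residue-window 4 1 (s≤s (s≤s z≤n)) t
  ... | c , c<4 , q , eq = c , ≤-trans c<4 (*-monoʳ-≤ 4 (s≤s z≤n)) , λ e → 0≢1+n (begin
    0                                  ≡⟨ cong bit (paperfolding-4w+1 q) ⟨
    letter (suc (q * 2 * 2))           ≡⟨ cong letter (trans (quadruple q) (sym eq)) ⟩
    letter (t + c)                     ≡⟨ e ⟩
    letter (t + suc (o * 2) * 2 + c)   ≡⟨ cong letter (trans (xy∙z≈xz∙y t (suc (o * 2) * 2) c) (cong (_+ suc (o * 2) * 2) eq)) ⟩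
    letter (q * 4 + 1 + suc (o * 2) * 2)  ≡⟨ cong letter (ring q o) ⟩
    letter (suc (suc ((q + o) * 2) * 2))  ≡⟨ cong bit (paperfolding-4w+3 (q + o)) ⟩
    1                                  ∎)
    where
    open ≡-Reasoning
    quadruple : ∀ q → suc (q * 2 * 2) ≡ q * 4 + 1
    quadruple = solve-∀
    ring : ∀ q o → q * 4 + 1 + suc (o * 2) * 2 ≡ suc (suc ((q + o) * 2) * 2)
    ring = solve-∀

  -- A mismatch at distance 2D near ⌈t/2⌉ doubles to one at distance 4D near t.
  even-step : ∀ D → P D → P (D * 2)
  even-step zero    _  ()
  even-step (suc D) ih _ t with residue-window 2 0 (s≤s z≤n) t
  ... | o , o<2 , t′ , t+o≡t′*2 with ih (s≤s z≤n) t′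
  ...   | c′ , c′<4D , mismatch = o + c′ * 2 , bound , mismatch ∘ halve
    where
    open ≤-Reasoning
    X : ℕ
    X = suc D * 2 * 2
    bound : o + c′ * 2 < 4 * (suc D * 2)
    bound = begin-strict
      o + c′ * 2       ≤⟨ +-monoˡ-≤ (c′ * 2) (m<1+n⇒m≤n o<2) ⟩
      suc (c′ * 2)     <⟨ n<1+n (suc (c′ * 2)) ⟩
      suc c′ * 2       ≤⟨ *-monoˡ-≤ 2 c′<4D ⟩
      4 * suc D * 2    ≡⟨ *-assoc 4 (suc D) 2 ⟩
      4 * (suc D * 2)  ∎
    halve : letter (t + (o + c′ * 2)) ≡ letter (t + X + (o + c′ * 2)) →
            letter (t′ + c′) ≡ letter (t′ + suc D * 2 + c′)
    halve e = begin-equality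
      letter (t′ + c′)                 ≡⟨ letter-double (t′ + c′) ⟨
      letter ((t′ + c′) * 2)           ≡⟨ cong letter (trans (cong (_+ c′ * 2) t+o≡t′*2) (low t′ c′)) ⟨
      letter (t + o + c′ * 2)          ≡⟨ cong letter (+-assoc t o (c′ * 2)) ⟩
      letter (t + (o + c′ * 2))        ≡⟨ e ⟩
      letter (t + X + (o + c′ * 2))    ≡⟨ cong letter (regroup t X o (c′ * 2)) ⟩
      letter (t + o + c′ * 2 + X)      ≡⟨ cong letter (cong (λ y → y + c′ * 2 + X) t+o≡t′*2) ⟩
      letter (t′ * 2 + 0 + c′ * 2 + X) ≡⟨ cong letter (high t′ c′ D) ⟩
      letter ((t′ + suc D * 2 + c′) * 2) ≡⟨ letter-double (t′ + suc D * 2 + c′) ⟩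
      letter (t′ + suc D * 2 + c′)     ∎
      where
      low : ∀ t c → t * 2 + 0 + c * 2 ≡ (t + c) * 2
      low = solve-∀
      regroup : ∀ t x o c → t + x + (o + c) ≡ t + o + c + x
      regroup = solve-∀
      high : ∀ t c D → t * 2 + 0 + c * 2 + suc D * 2 * 2 ≡ (t + suc D * 2 + c) * 2
      high = solve-∀

-- Counting ones

ones : List Bool → ℕ
ones bs = sum (map bit bs)

ones-++ : ∀ xs ys → ones (xs ++ ys) ≡ ones xs + ones ys
ones-++ xs ys = trans (cong sum (map-++ bit xs ys)) (sum-++ (map bit xs) (map bit ys))

parikh-ones : ∀ bs → proj₂ (parikh bs) ≡ ones bs
parikh-ones []           = refl
parikh-ones (false ∷ bs) with parikh bs | parikh-ones bs
... | _ , _ | eq = eq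
parikh-ones (true ∷ bs)  with parikh bs | parikh-ones bs
... | _ , _ | eq = cong suc eq

factor-+ : ∀ w p a b → factor w p (a + b) ≡ factor w p a ++ factor w (p + a) b
factor-+ w p zero    b = cong (λ q → factor w q b) (sym (+-identityʳ p))
factor-+ w p (suc a) b = cong (w p ∷_)
  (trans (factor-+ w (suc p) a b) (cong (λ q → factor w (suc p) a ++ factor w q b) (sym (+-suc p a))))

ones-factor-+ : ∀ w p a b → ones (factor w p (a + b)) ≡ ones (factor w p a) + ones (factor w (p + a) b)
ones-factor-+ w p a b = trans (cong ones (factor-+ w p a b)) (ones-++ (factor w p a) _)

map-blocks : ∀ {A : Set} (g : List Bool → A) w n pos k → (∀ i → pos (suc i) ≡ pos i + n) →
             map g (blocks w (pos 0) n k) ≡ applyUpTo (λ i → g (factor w (pos i) n)) k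
map-blocks g w n pos zero    _    = refl
map-blocks g w n pos (suc k) step = cong (g (factor w (pos 0) n) ∷_)
  (trans (cong (λ p → map g (blocks w p n k)) (sym (step 0))) (map-blocks g w n (pos ∘ suc) k (step ∘ suc)))

prefixOnes : ℕ → ℕ
prefixOnes n = ones (factor regularPaperfolding 1 n)

prefixOnes-suc : ∀ n → prefixOnes (suc n) ≡ prefixOnes n + letter (suc n)
prefixOnes-suc n = trans (cong prefixOnes (+-comm 1 n))
  (trans (ones-factor-+ regularPaperfolding 1 n 1) (cong (prefixOnes n +_) (+-identityʳ _)))

prefixOnes-odd : ∀ h → prefixOnes (suc (h * 2)) ≡ prefixOnes (h * 2) + h % 2
prefixOnes-odd h = trans (prefixOnes-suc (h * 2)) (cong (prefixOnes (h * 2) +_) (letter-odd h))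

prefixOnes-double : ∀ n → prefixOnes (n * 2) ≡ prefixOnes n + ⌊ n /2⌋
prefixOnes-double zero    = refl
prefixOnes-double (suc n) = begin
  prefixOnes (suc (suc (n * 2)))                          ≡⟨ prefixOnes-suc (suc (n * 2)) ⟩
  prefixOnes (suc (n * 2)) + letter (suc n * 2)           ≡⟨ cong₂ _+_ (prefixOnes-odd n) (letter-double (suc n)) ⟩
  prefixOnes (n * 2) + n % 2 + letter (suc n)             ≡⟨ cong (λ x → x + n % 2 + letter (suc n)) (prefixOnes-double n) ⟩
  prefixOnes n + ⌊ n /2⌋ + n % 2 + letter (suc n)         ≡⟨ cong (_+ letter (suc n)) (+-assoc (prefixOnes n) ⌊ n /2⌋ (n % 2)) ⟩
  prefixOnes n + (⌊ n /2⌋ + n % 2) + letter (suc n)       ≡⟨ xy∙z≈xz∙y (prefixOnes n) _ _ ⟩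
  (prefixOnes n + letter (suc n)) + (⌊ n /2⌋ + n % 2)     ≡⟨ cong₂ _+_ (prefixOnes-suc n) (⌊1+n/2⌋≡⌊n/2⌋+n%2 n) ⟨
  prefixOnes (suc n) + ⌊ suc n /2⌋                        ∎
  where open ≡-Reasoning

prefixOnes≤⌈n/2⌉ : ∀ n → prefixOnes n ≤ ⌈ n /2⌉
prefixOnes≤⌈n/2⌉ = binaryInduction (λ n → prefixOnes n ≤ ⌈ n /2⌉) z≤n
  (λ h ih → subst (prefixOnes (h * 2) ≤_) (sym (⌈n*2/2⌉≡n h)) (double≤ h ih))
  (λ h ih → begin
    prefixOnes (suc (h * 2)) ≡⟨ prefixOnes-odd h ⟩
    prefixOnes (h * 2) + h % 2 ≤⟨ +-mono-≤ (double≤ h ih) (≤-pred (m%n<n h 2)) ⟩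
    h + 1 ≡⟨ +-comm h 1 ⟩
    suc h ≡⟨ ⌈1+n*2/2⌉≡1+n h ⟨
    ⌈ suc (h * 2) /2⌉ ∎)
  where
  open ≤-Reasoning
  double≤ : ∀ h → prefixOnes h ≤ ⌈ h /2⌉ → prefixOnes (h * 2) ≤ h
  double≤ h ih = begin
    prefixOnes (h * 2)       ≡⟨ prefixOnes-double h ⟩
    prefixOnes h + ⌊ h /2⌋   ≤⟨ +-monoˡ-≤ ⌊ h /2⌋ ih ⟩
    ⌈ h /2⌉ + ⌊ h /2⌋        ≡⟨ +-comm ⌈ h /2⌉ ⌊ h /2⌋ ⟩
    ⌊ h /2⌋ + ⌈ h /2⌉        ≡⟨ ⌊n/2⌋+⌈n/2⌉≡n h ⟩
    h                        ∎

-- The deficit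

-- deficit n is the number of maximal runs of 1s in the binary expansion of n; this is why
-- deficit-concat holds.
opaque
  deficit : ℕ → ℕ
  deficit n = ⌈ n /2⌉ ∸ prefixOnes n

  prefixOnes+deficit : ∀ n → prefixOnes n + deficit n ≡ ⌈ n /2⌉
  prefixOnes+deficit n = m+[n∸m]≡n (prefixOnes≤⌈n/2⌉ n)

deficit-zero : deficit 0 ≡ 0
deficit-zero = prefixOnes+deficit 0

δ : ℕ → ℕ
δ t = t % 2 + letter (suc t)

δ<3 : ∀ t → δ t < 3
δ<3 t = +-mono-≤ (m%n<n t 2) (bit≤1 (regularPaperfolding (suc t)))
  where
  bit≤1 : ∀ b → bit b ≤ 1
  bit≤1 false = z≤n
  bit≤1 true  = ≤-refl

δ-even : ∀ h → δ (h * 2) ≡ h % 2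
δ-even h = cong₂ _+_ (m*n%n≡0 h 2) (letter-odd h)

-- For odd Δ, δ vanishes at multiples of 4 but not at odd numbers; for even Δ the parities
-- agree, so δ inherits the mismatch of letters.
δ-aperiodic : ∀ Δ → 0 < Δ → ∀ t → ∃[ c ] c < 4 * Δ × δ (t + c) ≢ δ (t + Δ + c)
δ-aperiodic Δ 0<Δ t with halving Δ
δ-aperiodic _ () t | even zero
... | even (suc D) with letter-aperiodic (suc D) (s≤s z≤n) (suc t)
...   | c , c<4D , neq = c , ≤-trans c<4D (*-monoʳ-≤ 4 (m≤m*n (suc D) 2)) ,
        λ e → neq (+-cancelˡ-≡ ((t + c) % 2) _ _ (trans e (cong (_+ letter (suc t + Δ′ + c)) parity≡)))
  where
  Δ′ : ℕ
  Δ′ = suc D * 2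
  parity≡ : (t + Δ′ + c) % 2 ≡ (t + c) % 2
  parity≡ = trans (%-congˡ (xy∙z≈xz∙y t Δ′ c)) ([m+kn]%n≡m%n (t + c) (suc D) 2)
δ-aperiodic _ _ t | odd o with residue-window 4 0 (s≤s z≤n) t
...   | c , c<4 , q , eq = c , ≤-trans c<4 (*-monoʳ-≤ 4 (s≤s z≤n)) , λ e → 0≢1+n (begin
  0                               ≡⟨ m*n%n≡0 q 2 ⟨
  q * 2 % 2                       ≡⟨ δ-even (q * 2) ⟨
  δ (q * 2 * 2)                   ≡⟨ cong δ (trans (quadruple q) (sym eq)) ⟩
  δ (t + c)                       ≡⟨ e ⟩
  δ (t + suc (o * 2) + c)         ≡⟨ cong δ (trans (xy∙z≈xz∙y t _ c) (cong (_+ suc (o * 2)) eq)) ⟩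
  δ (q * 4 + 0 + suc (o * 2))     ≡⟨ cong δ (ring q o) ⟩
  δ (suc ((q * 2 + o) * 2))       ≡⟨ cong (_+ letter (suc (suc ((q * 2 + o) * 2)))) ([1+h*2]%2≡1 (q * 2 + o)) ⟩
  suc (letter (suc (suc ((q * 2 + o) * 2)))) ∎)
  where
  open ≡-Reasoning
  quadruple : ∀ q → q * 2 * 2 ≡ q * 4 + 0
  quadruple = solve-∀
  ring : ∀ q o → q * 4 + 0 + suc (o * 2) ≡ suc ((q * 2 + o) * 2)
  ring = solve-∀

deficit-suc : ∀ t → deficit (suc t) + δ t ≡ deficit t + 1
deficit-suc t = +-cancelˡ-≡ (prefixOnes t) _ _ (begin
  prefixOnes t + (deficit (suc t) + (t % 2 + letter (suc t)))  ≡⟨ rearrange (prefixOnes t) _ _ _ ⟩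
  (prefixOnes t + letter (suc t) + deficit (suc t)) + t % 2    ≡⟨ cong (λ x → x + deficit (suc t) + t % 2) (prefixOnes-suc t) ⟨
  prefixOnes (suc t) + deficit (suc t) + t % 2                 ≡⟨ cong (_+ t % 2) (prefixOnes+deficit (suc t)) ⟩
  ⌈ suc t /2⌉ + t % 2                                          ≡⟨ ⌈1+n/2⌉+n%2≡⌈n/2⌉+1 t ⟩
  ⌈ t /2⌉ + 1                                                  ≡⟨ cong (_+ 1) (prefixOnes+deficit t) ⟨
  prefixOnes t + deficit t + 1                                 ≡⟨ +-assoc (prefixOnes t) (deficit t) 1 ⟩
  prefixOnes t + (deficit t + 1)                               ∎)
  where
  open ≡-Reasoning
  rearrange : ∀ p d r l → p + (d + (r + l)) ≡ p + l + d + r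
  rearrange = solve-∀

deficit-double : ∀ h → deficit (h * 2) ≡ deficit h
deficit-double h = +-cancelˡ-≡ (prefixOnes h + ⌊ h /2⌋) _ _ (begin
  prefixOnes h + ⌊ h /2⌋ + deficit (h * 2)  ≡⟨ cong (_+ deficit (h * 2)) (prefixOnes-double h) ⟨
  prefixOnes (h * 2) + deficit (h * 2)      ≡⟨ prefixOnes+deficit (h * 2) ⟩
  ⌈ h * 2 /2⌉                               ≡⟨ ⌈n*2/2⌉≡n h ⟩
  h                                         ≡⟨ ⌊n/2⌋+⌈n/2⌉≡n h ⟨
  ⌊ h /2⌋ + ⌈ h /2⌉                         ≡⟨ cong (⌊ h /2⌋ +_) (prefixOnes+deficit h) ⟨
  ⌊ h /2⌋ + (prefixOnes h + deficit h)      ≡⟨ rearrange ⌊ h /2⌋ (prefixOnes h) (deficit h) ⟩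
  prefixOnes h + ⌊ h /2⌋ + deficit h        ∎)
  where
  open ≡-Reasoning
  rearrange : ∀ f p d → f + (p + d) ≡ p + f + d
  rearrange = solve-∀

deficit-odd : ∀ h → deficit (suc (h * 2)) + h % 2 ≡ deficit h + 1
deficit-odd h = begin
  deficit (suc (h * 2)) + h % 2        ≡⟨ cong (deficit (suc (h * 2)) +_) (δ-even h) ⟨
  deficit (suc (h * 2)) + δ (h * 2)    ≡⟨ deficit-suc (h * 2) ⟩
  deficit (h * 2) + 1                  ≡⟨ cong (_+ 1) (deficit-double h) ⟩
  deficit h + 1                        ∎
  where open ≡-Reasoning

-- l < 2 ^ a leaves a 0 bit between the binary expansions of h and l.
deficit-concat : ∀ a h l → l < 2 ^ a → deficit (h * 2 ^ suc a + l) ≡ deficit h + deficit l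
deficit-concat zero h zero _ =
  trans (cong deficit (+-identityʳ (h * 2)))
        (trans (deficit-double h) (sym (trans (cong (deficit h +_) deficit-zero) (+-identityʳ (deficit h)))))
deficit-concat zero h (suc l) (s≤s ())
deficit-concat (suc a) h l l<2^a with halving l
... | even l′ = begin
  deficit (h * 2 ^ suc (suc a) + l′ * 2)  ≡⟨ cong deficit (shift h (2 ^ suc a) l′) ⟩
  deficit ((h * 2 ^ suc a + l′) * 2)      ≡⟨ deficit-double _ ⟩
  deficit (h * 2 ^ suc a + l′)            ≡⟨ deficit-concat a h l′ (half< l<2^a) ⟩
  deficit h + deficit l′                  ≡⟨ cong (deficit h +_) (deficit-double l′) ⟨
  deficit h + deficit (l′ * 2)            ∎
  where
  open ≡-Reasoning
  shift : ∀ h X l → h * (2 * X) + l * 2 ≡ (h * X + l) * 2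
  shift = solve-∀
  half< : l′ * 2 < 2 ^ suc a → l′ < 2 ^ a
  half< lt = *-cancelʳ-< 2 l′ (2 ^ a) (subst (l′ * 2 <_) (*-comm 2 (2 ^ a)) lt)
... | odd l′ = +-cancelʳ-≡ (l′ % 2) _ _ (begin
  deficit (h * 2 ^ suc (suc a) + suc (l′ * 2)) + l′ % 2 ≡⟨ cong (λ y → deficit y + l′ % 2) (shift h (2 ^ suc a) l′) ⟩
  deficit (suc (x * 2)) + l′ % 2        ≡⟨ cong (deficit (suc (x * 2)) +_) x%2≡l′%2 ⟨
  deficit (suc (x * 2)) + x % 2         ≡⟨ deficit-odd x ⟩
  deficit x + 1                         ≡⟨ cong (_+ 1) (deficit-concat a h l′ (half< l<2^a)) ⟩
  deficit h + deficit l′ + 1            ≡⟨ +-assoc (deficit h) (deficit l′) 1 ⟩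
  deficit h + (deficit l′ + 1)          ≡⟨ cong (deficit h +_) (deficit-odd l′) ⟨
  deficit h + (deficit (suc (l′ * 2)) + l′ % 2) ≡⟨ +-assoc (deficit h) _ (l′ % 2) ⟨
  deficit h + deficit (suc (l′ * 2)) + l′ % 2 ∎)
  where
  open ≡-Reasoning
  x : ℕ
  x = h * 2 ^ suc a + l′
  shift : ∀ h X l → h * (2 * X) + suc (l * 2) ≡ suc ((h * X + l) * 2)
  shift = solve-∀
  x%2≡l′%2 : x % 2 ≡ l′ % 2
  x%2≡l′%2 = trans (%-congˡ (trans (+-comm (h * 2 ^ suc a) l′) (cong (l′ +_) (trans (cong (h *_) (*-comm 2 (2 ^ a))) (sym (*-assoc h (2 ^ a) 2)))))) ([m+kn]%n≡m%n l′ (h * 2 ^ a) 2)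
  half< : suc (l′ * 2) < 2 ^ suc a → l′ < 2 ^ a
  half< lt = *-cancelʳ-< 2 l′ (2 ^ a) (subst (l′ * 2 <_) (*-comm 2 (2 ^ a)) (<-trans (n<1+n _) lt))

prefixOnes-double+deficit : ∀ y → prefixOnes (y * 2) + deficit y ≡ y
prefixOnes-double+deficit y = trans (cong (prefixOnes (y * 2) +_) (sym (deficit-double y)))
                                    (trans (prefixOnes+deficit (y * 2)) (⌈n*2/2⌉≡n y))

ones-window : ∀ y n → ones (factor regularPaperfolding (suc (y * 2)) (n * 2)) + deficit (y + n) ≡ n + deficit y
ones-window y n = +-cancelˡ-≡ (prefixOnes (y * 2)) _ _ (begin
  prefixOnes (y * 2) + (window + deficit (y + n))  ≡⟨ +-assoc (prefixOnes (y * 2)) window _ ⟨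
  prefixOnes (y * 2) + window + deficit (y + n)    ≡⟨ cong (_+ deficit (y + n)) (ones-factor-+ regularPaperfolding 1 (y * 2) (n * 2)) ⟨
  prefixOnes (y * 2 + n * 2) + deficit (y + n)     ≡⟨ cong (λ z → prefixOnes z + deficit (y + n)) (*-distribʳ-+ 2 y n) ⟨
  prefixOnes ((y + n) * 2) + deficit (y + n)       ≡⟨ prefixOnes-double+deficit (y + n) ⟩
  y + n                                            ≡⟨ cong (_+ n) (prefixOnes-double+deficit y) ⟨
  prefixOnes (y * 2) + deficit y + n               ≡⟨ xy∙z≈x∙zy (prefixOnes (y * 2)) (deficit y) n ⟩
  prefixOnes (y * 2) + (n + deficit y)             ∎)
  where
  open ≡-Reasoning
  window : ℕ
  window = ones (factor regularPaperfolding (suc (y * 2)) (n * 2))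

-- Ternary expansions

sumTo : ℕ → (ℕ → ℕ) → ℕ
sumTo zero    g = 0
sumTo (suc M) g = sumTo M g + g M

sumTo-cong : ∀ M {g h} → (∀ c → c < M → g c ≡ h c) → sumTo M g ≡ sumTo M h
sumTo-cong zero    _   = refl
sumTo-cong (suc M) g≡h = cong₂ _+_ (sumTo-cong M (λ c c<M → g≡h c (m<n⇒m<1+n c<M))) (g≡h M ≤-refl)

sumTo-+ : ∀ M g h → sumTo M (λ c → g c + h c) ≡ sumTo M g + sumTo M h
sumTo-+ zero    g h = refl
sumTo-+ (suc M) g h = trans (cong (_+ (g M + h M)) (sumTo-+ M g h))
                            (interchange (sumTo M g) (sumTo M h) (g M) (h M))

base3 : ℕ → (ℕ → ℕ) → ℕ
base3 M g = sumTo M (λ c → 3 ^ c * g c)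

base3-cong : ∀ M {g h} → (∀ c → c < M → g c ≡ h c) → base3 M g ≡ base3 M h
base3-cong M g≡h = sumTo-cong M (λ c c<M → cong (3 ^ c *_) (g≡h c c<M))

base3-+ : ∀ M g h → base3 M (λ c → g c + h c) ≡ base3 M g + base3 M h
base3-+ M g h = trans (sumTo-cong M (λ c _ → *-distribˡ-+ (3 ^ c) (g c) (h c)))
                      (sumTo-+ M (λ c → 3 ^ c * g c) (λ c → 3 ^ c * h c))

base3-< : ∀ M {g} → (∀ c → c < M → g c < 3) → base3 M g < 3 ^ M
base3-< zero    _   = s≤s z≤n
base3-< (suc M) {g} g<3 = begin-strict
  base3 M g + 3 ^ M * g M  <⟨ +-mono-<-≤ (base3-< M (λ c c<M → g<3 c (m<n⇒m<1+n c<M)))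
                                          (*-monoʳ-≤ (3 ^ M) (m<1+n⇒m≤n (g<3 M ≤-refl))) ⟩
  3 ^ M + 3 ^ M * 2        ≡⟨ *-suc (3 ^ M) 2 ⟨
  3 ^ M * 3                ≡⟨ *-comm (3 ^ M) 3 ⟩
  3 ^ suc M                ∎
  where open ≤-Reasoning

digits-unique : ∀ {x y n} a b → x < n → y < n → x + n * a ≡ y + n * b → x ≡ y × a ≡ b
digits-unique {x} {y} {n@(suc _)} a b x<n y<n eq = x≡y , *-cancelˡ-≡ a b n (+-cancelˡ-≡ x _ _ (trans eq (cong (_+ n * b) (sym x≡y))))
  where
  x≡y : x ≡ y
  x≡y = begin
    x                 ≡⟨ m<n⇒m%n≡m x<n ⟨
    x % n             ≡⟨ [m+kn]%n≡m%n x a n ⟨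
    (x + a * n) % n   ≡⟨ %-congˡ (trans (cong (x +_) (*-comm a n)) (trans eq (cong (y +_) (*-comm n b)))) ⟩
    (y + b * n) % n   ≡⟨ [m+kn]%n≡m%n y b n ⟩
    y % n             ≡⟨ m<n⇒m%n≡m y<n ⟩
    y                 ∎
    where open ≡-Reasoning

base3-injective : ∀ M {g h} → (∀ c → c < M → g c < 3) → (∀ c → c < M → h c < 3) →
                  base3 M g ≡ base3 M h → ∀ c → c < M → g c ≡ h c
base3-injective (suc M) {g} {h} g<3 h<3 eq c c<1+M =
  [ base3-injective M g<3′ h<3′ (proj₁ digits≡) c
  , (λ c≡M → subst (λ c → g c ≡ h c) (sym c≡M) (proj₂ digits≡)) ]′ (m<1+n⇒m<n∨m≡n c<1+M)
  where
  g<3′ : ∀ c → c < M → g c < 3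
  g<3′ c c<M = g<3 c (m<n⇒m<1+n c<M)
  h<3′ : ∀ c → c < M → h c < 3
  h<3′ c c<M = h<3 c (m<n⇒m<1+n c<M)
  digits≡ : base3 M g ≡ base3 M h × g M ≡ h M
  digits≡ = digits-unique (g M) (h M) (base3-< M g<3′) (base3-< M h<3′) eq

-- Concatenating binary blocks

repunit : ℕ → ℕ → ℕ
repunit a zero    = 0
repunit a (suc k) = repunit a k * 2 ^ suc a + 1

deficit-*-repunit : ∀ a s k → s < 2 ^ a → deficit (s * repunit a k) ≡ k * deficit s
deficit-*-repunit a s zero    _    = trans (cong deficit (*-zeroʳ s)) deficit-zero
deficit-*-repunit a s (suc k) s<2^a = begin
  deficit (s * (repunit a k * 2 ^ suc a + 1))  ≡⟨ cong deficit (distrib s (repunit a k) (2 ^ suc a)) ⟩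
  deficit (s * repunit a k * 2 ^ suc a + s)    ≡⟨ deficit-concat a (s * repunit a k) s s<2^a ⟩
  deficit (s * repunit a k) + deficit s        ≡⟨ cong (_+ deficit s) (deficit-*-repunit a s k s<2^a) ⟩
  k * deficit s + deficit s                    ≡⟨ +-comm (k * deficit s) (deficit s) ⟩
  suc k * deficit s                            ∎
  where
  open ≡-Reasoning
  distrib : ∀ s r X → s * (r * X + 1) ≡ s * r * X + s
  distrib = solve-∀

pack : (ℕ → ℕ) → (ℕ → ℕ) → ℕ → ℕ
pack width x zero    = 0
pack width x (suc c) = pack width x c * 2 ^ suc (width c) + x c

deficit-pack : ∀ width x M → (∀ c → c < M → x c < 2 ^ width c) →
               deficit (pack width x M) ≡ sumTo M (λ c → deficit (x c))
deficit-pack width x zero    _    = deficit-zero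
deficit-pack width x (suc M) x<2^ = trans (deficit-concat (width M) (pack width x M) (x M) (x<2^ M ≤-refl))
  (cong (_+ deficit (x M)) (deficit-pack width x M (λ c c<M → x<2^ c (m<n⇒m<1+n c<M))))

pack-+ : ∀ width {x y z} M → (∀ c → z c ≡ x c + y c) → pack width z M ≡ pack width x M + pack width y M
pack-+ width zero    _      = refl
pack-+ width {x} {y} {z} (suc M) z≡x+y = begin
  pack width z M * X + z M                            ≡⟨ cong₂ (λ p d → p * X + d) (pack-+ width M z≡x+y) (z≡x+y M) ⟩
  (pack width x M + pack width y M) * X + (x M + y M) ≡⟨ distrib (pack width x M) (pack width y M) X (x M) (y M) ⟩
  (pack width x M * X + x M) + (pack width y M * X + y M) ∎
  where
  open ≡-Reasoning
  X : ℕ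
  X = 2 ^ suc (width M)
  distrib : ∀ p q X a b → (p + q) * X + (a + b) ≡ (p * X + a) + (q * X + b)
  distrib = solve-∀

-- The construction

-- Y j is the binary concatenation over c < M of digit j c, that is of 3^c copies of j + c;
-- the field widths are those for j = m, so they serve every j ≤ m.
module AntipowerConstruction (m : ℕ) where

  M : ℕ
  M = 4 * m

  R : ℕ → ℕ
  R c = repunit (m + M) (3 ^ c)

  digit : ℕ → ℕ → ℕ
  digit j c = (j + c) * R c

  Y : ℕ → ℕ
  Y j = pack (digit m) (digit j) M

  N : ℕ
  N = pack (digit m) R M

  block : ℕ → List Bool
  block j = factor regularPaperfolding (suc (Y j * 2)) (N * 2)

  Y-suc : ∀ j → Y (suc j) ≡ Y j + N
  Y-suc j = pack-+ (digit m) M (λ c → +-comm (R c) (digit j c))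

  deficit-Y : ∀ j → j ≤ m → deficit (Y j) ≡ base3 M (λ c → deficit (j + c))
  deficit-Y j j≤m = trans (deficit-pack (digit m) (digit j) M digit<)
    (sumTo-cong M (λ c c<M → deficit-*-repunit (m + M) (j + c) (3 ^ c)
                               (<-≤-trans (+-mono-≤-< j≤m c<M) (<⇒≤ (n<2^n (m + M))))))
    where
    digit< : ∀ c → c < M → digit j c < 2 ^ digit m c
    digit< c _ = ≤-<-trans (*-monoˡ-≤ (R c) (+-monoˡ-≤ c j≤m)) (n<2^n (digit m c))

  deficit-Y-suc : ∀ j → j < m →
                  deficit (Y (suc j)) + base3 M (λ c → δ (j + c)) ≡ deficit (Y j) + base3 M (λ _ → 1)
  deficit-Y-suc j j<m = begin
    deficit (Y (suc j)) + base3 M (λ c → δ (j + c))    ≡⟨ cong (_+ base3 M (λ c → δ (j + c))) (deficit-Y (suc j) j<m) ⟩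
    base3 M (λ c → deficit (suc j + c)) + base3 M (λ c → δ (j + c)) ≡⟨ base3-+ M _ _ ⟨
    base3 M (λ c → deficit (suc (j + c)) + δ (j + c))  ≡⟨ base3-cong M (λ c _ → deficit-suc (j + c)) ⟩
    base3 M (λ c → deficit (j + c) + 1)                ≡⟨ base3-+ M _ _ ⟩
    base3 M (λ c → deficit (j + c)) + base3 M (λ _ → 1) ≡⟨ cong (_+ base3 M (λ _ → 1)) (deficit-Y j (<⇒≤ j<m)) ⟨
    deficit (Y j) + base3 M (λ _ → 1)                  ∎
    where open ≡-Reasoning

  ones-block : ∀ j → j < m → ones (block j) + base3 M (λ _ → 1) ≡ N + base3 M (λ c → δ (j + c))
  ones-block j j<m = +-cancelʳ-≡ A _ _ (begin
    O + K + A                  ≡⟨ xy∙z≈xz∙y O K A ⟩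
    O + A + K                  ≡⟨ cong (λ y → O + deficit y + K) (Y-suc j) ⟩
    O + deficit (Y j + N) + K  ≡⟨ cong (_+ K) (ones-window (Y j) N) ⟩
    N + P + K                  ≡⟨ +-assoc N P K ⟩
    N + (P + K)                ≡⟨ cong (N +_) (deficit-Y-suc j j<m) ⟨
    N + (A + D)                ≡⟨ cong (N +_) (+-comm A D) ⟩
    N + (D + A)                ≡⟨ +-assoc N D A ⟨
    N + D + A                  ∎)
    where
    open ≡-Reasoning
    O A P K D : ℕ
    O = ones (block j)
    A = deficit (Y (suc j))
    P = deficit (Y j)
    K = base3 M (λ _ → 1)
    D = base3 M (λ c → δ (j + c))

  block-ones-injective : ∀ {j j′} → j < j′ → j′ < m → ones (block j) ≢ ones (block j′)
  block-ones-injective {j} {j′} j<j′ j′<m eq with m≤n⇒∃[o]m+o≡n j<j′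
  ... | k , 1+j+k≡j′ with δ-aperiodic (suc k) (s≤s z≤n) j
  ...   | c , c<4Δ , δ≢ = δ≢ (trans (δ≡ c c<M) (cong (λ x → δ (x + c)) (sym j+Δ≡j′)))
    where
    j+Δ≡j′ : j + suc k ≡ j′
    j+Δ≡j′ = trans (+-suc j k) 1+j+k≡j′
    c<M : c < M
    c<M = <-≤-trans c<4Δ (*-monoʳ-≤ 4 (≤-trans (m≤n+m (suc k) j) (≤-trans (≤-reflexive j+Δ≡j′) (<⇒≤ j′<m))))
    δ-digits≡ : base3 M (λ c → δ (j + c)) ≡ base3 M (λ c → δ (j′ + c))
    δ-digits≡ = +-cancelˡ-≡ N _ _ (begin
      N + base3 M (λ c → δ (j + c))              ≡⟨ ones-block j (<-trans j<j′ j′<m) ⟨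
      ones (block j) + base3 M (λ _ → 1)         ≡⟨ cong (_+ base3 M (λ _ → 1)) eq ⟩
      ones (block j′) + base3 M (λ _ → 1)        ≡⟨ ones-block j′ j′<m ⟩
      N + base3 M (λ c → δ (j′ + c))             ∎)
      where open ≡-Reasoning
    δ≡ : ∀ c → c < M → δ (j + c) ≡ δ (j′ + c)
    δ≡ = base3-injective M (λ c _ → δ<3 (j + c)) (λ c _ → δ<3 (j′ + c)) δ-digits≡

mainTheorem4 : (m : ℕ) → 2 ≤ m → HasAbelianAntipowerFactor regularPaperfolding m
mainTheorem4 m _ = suc (Y 0 * 2) , N * 2 , s≤s z≤n ,
  subst (AllPairs _≢_) (sym (map-blocks parikh regularPaperfolding (N * 2) position m position-suc))
    (applyUpTo⁺₁ (parikh ∘ block) m (λ {i} {j} i<j j<m e →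
      block-ones-injective i<j j<m (trans (sym (parikh-ones (block i))) (trans (cong proj₂ e) (parikh-ones (block j))))))
  where
  open AntipowerConstruction m
  position : ℕ → ℕ
  position j = suc (Y j * 2)
  position-suc : ∀ j → position (suc j) ≡ position j + N * 2
  position-suc j = cong suc (trans (cong (_* 2) (Y-suc j)) (*-distribʳ-+ 2 (Y j) N))
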